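{- Let $G=\{(A_1,X_1),\dots,(A_n,X_n)\}$ be a finite set of I/O pairs and $(B,Y)$ a pair. Put $G^\square_{1/2}=\{\square A_i\to X_i\mid (A_i,X_i)\in G\}$ and $G^\square_{3/4}=\{\square A_i\to X_i\wedge\square X_i\mid (A_i,X_i)\in G\}$. Then: (1) $G\vdash_{OUT_1}(B,Y)$ iff $G^\square_{1/2}\models_{\mathbf{K}}\square B\to Y$, and $G\vdash_{OUT_2}(B,Y)$ iff $G^\square_{1/2}\models_{\mathbf{K+F}}\square B\to Y$; (2) $G\vdash_{OUT_3}(B,Y)$ iff $G^\square_{3/4}\models_{\mathbf{K}}\square B\to Y\wedge\square Y$, and $G\vdash_{OUT_4}(B,Y)$ iff $G^\square_{3/4}\models_{\mathbf{K+F}}\square B\to Y\wedge\square Y$; (3) $G\vdash_{OUT_1^+}(B,Y)$ iff $G^\square_{1/2}\models_{\mathbf{KD}}\square B\to Y$, and $G\vdash_{OUT_2^+}(B,Y)$ iff $G^\square_{1/2}\models_{\mathbf{KD+F}}\square B\to Y$; (4) $G\vdash_{OUT_3^+}(B,Y)$ iff $G^\square_{3/4}\models_{\mathbf{KD}}\square B\to Y\wedge\square Y$, and $G\vdash_{OUT_4^+}(B,Y)$ iff $G^\square_{3/4}\models_{\mathbf{KD+F}}\square B\to Y\wedge\square Y$.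
   Context: Formulas $A_i,X_i,B,Y$ are classical propositional formulas built with $\top,\bot,\neg,\wedge,\vee,\to$; $\models$ denotes classical semantic entailment. An I/O pair is an ordered pair $(A,X)$ of formulas. Rules on pairs: (TOP) $(\top,\top)$ is derivable from no premises; (BOT) $(\bot,\bot)$ is derivable from no premises; (WO) from $(A,X)$ derive $(A,Y)$ whenever $X\models Y$; (SI) from $(A,X)$ derive $(B,X)$ whenever $B\models A$; (AND) from $(A,X_1)$ and $(A,X_2)$ derive $(A,X_1\wedge X_2)$; (OR) from $(A_1,X)$ and $(A_2,X)$ derive $(A_1\vee A_2,X)$; (CT) from $(A,X)$ and $(A\wedge X,Y)$ derive $(A,Y)$. The logics: $OUT_1$ = {TOP, WO, SI, AND}; $OUT_2$ = $OUT_1$ + OR; $OUT_3$ = $OUT_1$ + CT; $OUT_4$ = $OUT_1$ + OR + CT; $OUT_k^+$ = $OUT_k$ + BOT. $G\vdash_{L}(B,Y)$ means there is a finite tree with root $(B,Y)$, each leaf an element of $G$ or an axiom of $L$, and each non-leaf node obtained from its children by a rule of $L$. $\mathbf{K}$ is the basic normal modal logic; $\mathbf{D}$ is the axiom $\square A\to\Diamond A$ and $\mathbf{F}$ is the axiom $\Diamond A\to\square A$; $\mathbf{KD}$, $\mathbf{K+F}$, $\mathbf{KD+F}$ are the corresponding normal extensions (characterized respectively by Kripke frames where every world has at least one successor, at most one successor, exactly one successor). For a normal modal logic $L$, $\Sigma\models_L\varphi$ means (local consequence): in every Kripke model based on a frame for $L$, every world satisfying all formulas of $\Sigma$ satisfies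 $\varphi$. -}

module Defs where

open import Data.Nat using (ℕ)
open import Data.Bool using (Bool; true; false; not; _∧_; _∨_)
open import Data.List using (List; map)
open import Data.List.Membership.Propositional using (_∈_)
open import Data.Product using (Σ; _×_; _,_)
open import Data.Sum using (_⊎_)
open import Data.Unit using (⊤)
open import Data.Empty using (⊥)
open import Relation.Binary.PropositionalEquality using (_≡_)
open import Level using (Level; suc; zero)

data PForm : Set where
  atom : ℕ → PForm
  ⊤ᶠ ⊥ᶠ : PForm
  ¬ᶠ_ : PForm → PForm
  _∧ᶠ_ _∨ᶠ_ _⇒ᶠ_ : PForm → PForm → PForm

infixr 6 _∧ᶠ_
infixr 5 _∨ᶠ_
infixr 4 _⇒ᶠ_

eval : (ℕ → Bool) → PForm → Bool
eval v (atom p) = v p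
eval v ⊤ᶠ = true
eval v ⊥ᶠ = false
eval v (¬ᶠ a) = not (eval v a)
eval v (a ∧ᶠ b) = eval v a ∧ eval v b
eval v (a ∨ᶠ b) = eval v a ∨ eval v b
eval v (a ⇒ᶠ b) = not (eval v a) ∨ eval v b

_⊨_ : PForm → PForm → Set
A ⊨ B = (v : ℕ → Bool) → eval v A ≡ true → eval v B ≡ true

Pair : Set
Pair = PForm × PForm

-- which optional rules a system contains (TOP, WO, SI, AND always present)
record Sys : Set where
  constructor sys
  field
    hasOR  : Bool
    hasCT  : Bool
    hasBOT : Bool
open Sys public

OUT₁ OUT₂ OUT₃ OUT₄ OUT₁⁺ OUT₂⁺ OUT₃⁺ OUT₄⁺ : Sys
OUT₁  = sys false false false
OUT₂  = sys true  false false
OUT₃  = sys false true  false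
OUT₄  = sys true  true  false
OUT₁⁺ = sys false false true
OUT₂⁺ = sys true  false true
OUT₃⁺ = sys false true  true
OUT₄⁺ = sys true  true  true

data _⊢[_]_ (G : List Pair) (L : Sys) : Pair → Set where
  leaf : ∀ {p} → p ∈ G → G ⊢[ L ] p
  TOP  : G ⊢[ L ] (⊤ᶠ , ⊤ᶠ)
  BOT  : hasBOT L ≡ true → G ⊢[ L ] (⊥ᶠ , ⊥ᶠ)
  WO   : ∀ {A X Y} → G ⊢[ L ] (A , X) → X ⊨ Y → G ⊢[ L ] (A , Y)
  SI   : ∀ {A B X} → G ⊢[ L ] (A , X) → B ⊨ A → G ⊢[ L ] (B , X)
  AND  : ∀ {A X₁ X₂} → G ⊢[ L ] (A , X₁) → G ⊢[ L ] (A , X₂)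
       → G ⊢[ L ] (A , X₁ ∧ᶠ X₂)
  OR   : ∀ {A₁ A₂ X} → hasOR L ≡ true → G ⊢[ L ] (A₁ , X) → G ⊢[ L ] (A₂ , X)
       → G ⊢[ L ] (A₁ ∨ᶠ A₂ , X)
  CT   : ∀ {A X Y} → hasCT L ≡ true → G ⊢[ L ] (A , X) → G ⊢[ L ] (A ∧ᶠ X , Y)
       → G ⊢[ L ] (A , Y)

data MForm : Set where
  atom : ℕ → MForm
  ⊤ᵐ ⊥ᵐ : MForm
  ¬ᵐ_ : MForm → MForm
  _∧ᵐ_ _∨ᵐ_ _⇒ᵐ_ : MForm → MForm → MForm
  □_ : MForm → MForm

infixr 6 _∧ᵐ_
infixr 5 _∨ᵐ_
infixr 4 _⇒ᵐ_
infix 7 □_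

⌜_⌝ : PForm → MForm
⌜ atom p ⌝ = atom p
⌜ ⊤ᶠ ⌝ = ⊤ᵐ
⌜ ⊥ᶠ ⌝ = ⊥ᵐ
⌜ ¬ᶠ a ⌝ = ¬ᵐ ⌜ a ⌝
⌜ a ∧ᶠ b ⌝ = ⌜ a ⌝ ∧ᵐ ⌜ b ⌝
⌜ a ∨ᶠ b ⌝ = ⌜ a ⌝ ∨ᵐ ⌜ b ⌝
⌜ a ⇒ᶠ b ⌝ = ⌜ a ⌝ ⇒ᵐ ⌜ b ⌝

record Model : Set₁ where
  field
    W : Set
    R : W → W → Set
    V : W → ℕ → Bool
open Model public

_,_⊩_ : (M : Model) → W M → MForm → Set
M , w ⊩ atom p = V M w p ≡ true
M , w ⊩ ⊤ᵐ = ⊤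
M , w ⊩ ⊥ᵐ = ⊥
M , w ⊩ (¬ᵐ a) = M , w ⊩ a → ⊥
M , w ⊩ (a ∧ᵐ b) = (M , w ⊩ a) × (M , w ⊩ b)
M , w ⊩ (a ∨ᵐ b) = (M , w ⊩ a) ⊎ (M , w ⊩ b)
M , w ⊩ (a ⇒ᵐ b) = M , w ⊩ a → M , w ⊩ b
M , w ⊩ (□ a) = (u : W M) → R M w u → M , u ⊩ a

Serial : Model → Set
Serial M = (w : W M) → Σ (W M) (R M w)

AtMostOneSucc : Model → Set
AtMostOneSucc M = (w u u′ : W M) → R M w u → R M w u′ → u ≡ u′

-- the four modal logics, by their characterizing frame classes
data ModalLogic : Set where
  K KD K+F KD+F : ModalLogic

FrameOf : ModalLogic → Model → Set
FrameOf K    M = ⊤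
FrameOf KD   M = Serial M
FrameOf K+F  M = AtMostOneSucc M
FrameOf KD+F M = Serial M × AtMostOneSucc M

_⊨[_]_ : List MForm → ModalLogic → MForm → Set₁
Γ ⊨[ L ] φ = (M : Model) → FrameOf L M → (w : W M)
           → ((ψ : MForm) → ψ ∈ Γ → M , w ⊩ ψ) → M , w ⊩ φ

tr₁₂ : Pair → MForm
tr₁₂ (A , X) = □ ⌜ A ⌝ ⇒ᵐ ⌜ X ⌝

tr₃₄ : Pair → MForm
tr₃₄ (A , X) = □ ⌜ A ⌝ ⇒ᵐ (⌜ X ⌝ ∧ᵐ □ ⌜ X ⌝)

G□₁₂ : List Pair → List MForm
G□₁₂ G = map tr₁₂ G

G□₃₄ : List Pair → List MForm
G□₃₄ G = map tr₃₄ G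

-- Soundness is an induction on derivations: seriality validates BOT, having at most one
-- successor lets □(A₁ ∨ A₂) be split so that OR is valid, and CT is valid for the second
-- translation because it carries □X along with X.
--
-- Completeness: saturate G from B, letting (A , X) join U once the context entails A, where
-- the context is B, or B ∧ ⋀U in the presence of CT; B then derives every output of U. If a
-- valuation v made the outputs of U true and Y false, the fan with root v whose successors
-- are all models of the context would satisfy the premises and □B but not the conclusion,
-- since its root forces □A only when the context entails A, that is when (A , X) ∈ U.
-- Hence ⋀U ⊨ Y and WO concludes. When frames have at most one successor, B is first split
-- by OR along the minterms over the atoms of the antecedents; such a context decides every
-- antecedent, so a single model of it can stand for all of them. An unsatisfiable context
-- yields the empty fan or, in the serial logics, is dispatched by BOT.

module Submission where

open import Defs
open import Data.Bool using (Bool; true; false; not; _∧_; _∨_)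
open import Data.Bool.Properties using (_≟_; ∨-zeroʳ; ∨-inverseʳ; ∧-assoc; ¬-not; not-¬)
open import Data.Empty using (⊥; ⊥-elim)
open import Data.Fin using (toℕ; fromℕ<)
open import Data.Fin.Properties using (toℕ-fromℕ<)
open import Data.Fin.Subset.Properties using (anySubset?)
open import Data.List using (List; []; _∷_; _++_; map; filter; length)
open import Data.List.Extrema.Nat using (max; xs≤max)
open import Data.List.Membership.Propositional using (_∈_; lose)
open import Data.List.Membership.Propositional.Properties
  using (∈-map⁺; ∈-map⁻; ∈-filter⁺; ∈-filter⁻; ∈-++⁺ˡ; ∈-++⁺ʳ; ∈-++⁻)
open import Data.List.Properties using (filter-notAll)
import Data.List.Relation.Unary.All as All
open import Data.List.Relation.Unary.Any as Any using (here; there; any?)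
open import Data.Maybe using (Maybe; just; nothing; maybe)
open import Data.Nat using (ℕ; zero; suc; _<_; _≤_; _⊔_; _<?_)
open import Data.Nat.Induction using (<-wellFounded)
open import Data.Nat.Properties using (<-≤-trans; n<1+n; m≤m⊔n; m≤n⊔m; m<1+n⇒m<n∨m≡n)
open import Data.Product using (∃; _×_; _,_; proj₁; proj₂)
open import Data.Sum using (_⊎_; inj₁; inj₂; [_,_]′)
open import Data.Unit using (tt) renaming (⊤ to Unit)
open import Data.Vec using (Vec; []; _∷_; lookup; tabulate)
open import Data.Vec.Properties using (lookup∘tabulate)
open import Function using (id; _∘_)
open import Function.Bundles using (_⇔_; mk⇔)
open import Induction.WellFounded using (Acc; acc)
open import Relation.Binary.PropositionalEquality using (_≡_; refl; sym; trans; cong; cong₂; subst)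
open import Relation.Nullary using (Dec; yes; no)
open import Relation.Nullary.Decidable using (_×-dec_; ¬?)
open import Relation.Nullary.Irrelevant using (Irrelevant)
open import Relation.Unary using (Pred; Decidable; ∁)

∧-intro : ∀ {x y} → x ≡ true → y ≡ true → x ∧ y ≡ true
∧-intro refl refl = refl

∧-elimˡ : ∀ {x y} → x ∧ y ≡ true → x ≡ true
∧-elimˡ {true} _ = refl

∧-elimʳ : ∀ {x y} → x ∧ y ≡ true → y ≡ true
∧-elimʳ {true} h = h

mutual
  forces⇒eval : ∀ {M w} A → M , w ⊩ ⌜ A ⌝ → eval (V M w) A ≡ true
  forces⇒eval (atom p) h = h
  forces⇒eval ⊤ᶠ _ = refl
  forces⇒eval {M} {w} (¬ᶠ a) h with eval (V M w) a in eq
  ... | true  = ⊥-elim (h (eval⇒forces a eq))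
  ... | false = refl
  forces⇒eval (a ∧ᶠ b) (ha , hb) = ∧-intro (forces⇒eval a ha) (forces⇒eval b hb)
  forces⇒eval (a ∨ᶠ b) (inj₁ ha) rewrite forces⇒eval a ha = refl
  forces⇒eval {M} {w} (a ∨ᶠ b) (inj₂ hb) rewrite forces⇒eval b hb = ∨-zeroʳ (eval (V M w) a)
  forces⇒eval {M} {w} (a ⇒ᶠ b) h with eval (V M w) a in eq
  ... | true  = forces⇒eval b (h (eval⇒forces a eq))
  ... | false = refl

  eval⇒forces : ∀ {M w} A → eval (V M w) A ≡ true → M , w ⊩ ⌜ A ⌝
  eval⇒forces (atom p) h = h
  eval⇒forces ⊤ᶠ _ = tt
  eval⇒forces {M} {w} (¬ᶠ a) h ha with eval (V M w) a | forces⇒eval {M} {w} a ha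
  eval⇒forces (¬ᶠ a) () ha | true | refl
  eval⇒forces (a ∧ᶠ b) h = eval⇒forces a (∧-elimˡ h) , eval⇒forces b (∧-elimʳ h)
  eval⇒forces {M} {w} (a ∨ᶠ b) h with eval (V M w) a in eq
  ... | true  = inj₁ (eval⇒forces a eq)
  ... | false = inj₂ (eval⇒forces b h)
  eval⇒forces {M} {w} (a ⇒ᶠ b) h ha with eval (V M w) a | forces⇒eval {M} {w} a ha
  ... | true | refl = eval⇒forces b h

⊨⇒forces : ∀ {A X M w} → A ⊨ X → M , w ⊩ ⌜ A ⌝ → M , w ⊩ ⌜ X ⌝
⊨⇒forces {A} {X} {M} {w} A⊨X h = eval⇒forces X (A⊨X (V M w) (forces⇒eval A h))

forces? : ∀ {M w} A → Dec (M , w ⊩ ⌜ A ⌝)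
forces? {M} {w} A with eval (V M w) A in eq
... | true  = yes (eval⇒forces A eq)
... | false = no λ h → not-¬ eq (forces⇒eval A h)

logicOf : Sys → ModalLogic
logicOf (sys false _ false) = K
logicOf (sys false _ true)  = KD
logicOf (sys true  _ false) = K+F
logicOf (sys true  _ true)  = KD+F

OR⇒functional : ∀ L {M} → hasOR L ≡ true → FrameOf (logicOf L) M → AtMostOneSucc M
OR⇒functional (sys true _ false) _ fr = fr
OR⇒functional (sys true _ true)  _ fr = proj₂ fr

BOT⇒serial : ∀ L {M} → hasBOT L ≡ true → FrameOf (logicOf L) M → Serial M
BOT⇒serial (sys false _ true) _ fr = fr
BOT⇒serial (sys true  _ true) _ fr = proj₁ fr

functional-□ : ∀ {M w u} φ → AtMostOneSucc M → R M w u → M , u ⊩ φ → M , w ⊩ (□ φ)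
functional-□ {M} {w} {u} φ fun r h u′ r′ = subst (λ x → M , x ⊩ φ) (fun w u u′ r r′) h

serial-□⊥ : ∀ {M} → Serial M → ∀ w → M , w ⊩ (□ ⊥ᵐ) → ⊥
serial-□⊥ ser w □⊥ = □⊥ (proj₁ (ser w)) (proj₂ (ser w))

-- A world may lack a successor, in which case □(φ ∨ ψ) cannot be split; deciding Q sidesteps this.
□-∨-elim : ∀ {M w} {Q : Set} φ ψ → AtMostOneSucc M → Dec Q → M , w ⊩ (□ (φ ∨ᵐ ψ))
         → (M , w ⊩ (□ φ) → Q) → (M , w ⊩ (□ ψ) → Q) → Q
□-∨-elim φ ψ fun (yes q) _ _ _ = q
□-∨-elim {M} {w} φ ψ fun (no ¬q) □φ∨ψ kφ kψ = kφ □φ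
  where
  □φ : M , w ⊩ (□ φ)
  □φ u r with □φ∨ψ u r
  ... | inj₁ hφ = hφ
  ... | inj₂ hψ = ⊥-elim (¬q (kψ (functional-□ ψ fun r hψ)))

sound₁₂ : ∀ {G L p} → hasCT L ≡ false → G ⊢[ L ] p → G□₁₂ G ⊨[ logicOf L ] tr₁₂ p
sound₁₂ _ (leaf {p} p∈G) M fr w Γ = Γ (tr₁₂ p) (∈-map⁺ tr₁₂ p∈G)
sound₁₂ _ TOP M fr w Γ _ = tt
sound₁₂ {L = L} _ (BOT e) M fr w Γ = serial-□⊥ {M} (BOT⇒serial L e fr) w
sound₁₂ noCT (WO d X⊨Y) M fr w Γ □A = ⊨⇒forces X⊨Y (sound₁₂ noCT d M fr w Γ □A)
sound₁₂ noCT (SI d B⊨A) M fr w Γ □B = sound₁₂ noCT d M fr w Γ λ u r → ⊨⇒forces B⊨A (□B u r)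
sound₁₂ noCT (AND d₁ d₂) M fr w Γ □A = sound₁₂ noCT d₁ M fr w Γ □A , sound₁₂ noCT d₂ M fr w Γ □A
sound₁₂ {L = L} noCT (OR {A₁} {A₂} {X} e d₁ d₂) M fr w Γ □A =
  □-∨-elim ⌜ A₁ ⌝ ⌜ A₂ ⌝ (OR⇒functional L e fr) (forces? X) □A
    (sound₁₂ noCT d₁ M fr w Γ) (sound₁₂ noCT d₂ M fr w Γ)
sound₁₂ noCT (CT e _ _) = ⊥-elim (not-¬ noCT e)

sound₃₄ : ∀ {G L p} → G ⊢[ L ] p → G□₃₄ G ⊨[ logicOf L ] tr₃₄ p
sound₃₄ (leaf {p} p∈G) M fr w Γ = Γ (tr₃₄ p) (∈-map⁺ tr₃₄ p∈G)
sound₃₄ TOP M fr w Γ _ = tt , λ _ _ → tt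
sound₃₄ {L = L} (BOT e) M fr w Γ = ⊥-elim ∘ serial-□⊥ {M} (BOT⇒serial L e fr) w
sound₃₄ (WO d X⊨Y) M fr w Γ □A with sound₃₄ d M fr w Γ □A
... | x , □x = ⊨⇒forces X⊨Y x , λ u r → ⊨⇒forces X⊨Y (□x u r)
sound₃₄ (SI d B⊨A) M fr w Γ □B = sound₃₄ d M fr w Γ λ u r → ⊨⇒forces B⊨A (□B u r)
sound₃₄ (AND d₁ d₂) M fr w Γ □A with sound₃₄ d₁ M fr w Γ □A | sound₃₄ d₂ M fr w Γ □A
... | x₁ , □x₁ | x₂ , □x₂ = (x₁ , x₂) , λ u r → □x₁ u r , □x₂ u r
sound₃₄ {L = L} (OR {A₁} {A₂} {X} e d₁ d₂) M fr w Γ □A = x , □x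
  where
  fun : AtMostOneSucc M
  fun = OR⇒functional L e fr
  ih₁ : M , w ⊩ (□ ⌜ A₁ ⌝) → M , w ⊩ (⌜ X ⌝ ∧ᵐ □ ⌜ X ⌝)
  ih₁ = sound₃₄ d₁ M fr w Γ
  ih₂ : M , w ⊩ (□ ⌜ A₂ ⌝) → M , w ⊩ (⌜ X ⌝ ∧ᵐ □ ⌜ X ⌝)
  ih₂ = sound₃₄ d₂ M fr w Γ
  x : M , w ⊩ ⌜ X ⌝
  x = □-∨-elim ⌜ A₁ ⌝ ⌜ A₂ ⌝ fun (forces? X) □A (proj₁ ∘ ih₁) (proj₁ ∘ ih₂)
  □x : M , w ⊩ (□ ⌜ X ⌝)
  □x u r = [ (λ a₁ → proj₂ (ih₁ (functional-□ ⌜ A₁ ⌝ fun r a₁)) u r)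
           , (λ a₂ → proj₂ (ih₂ (functional-□ ⌜ A₂ ⌝ fun r a₂)) u r) ]′ (□A u r)
sound₃₄ (CT e d₁ d₂) M fr w Γ □A with sound₃₄ d₁ M fr w Γ □A
... | _ , □x = sound₃₄ d₂ M fr w Γ λ u r → □A u r , □x u r

bound : PForm → ℕ
bound (atom p) = suc p
bound ⊤ᶠ = 0
bound ⊥ᶠ = 0
bound (¬ᶠ a) = bound a
bound (a ∧ᶠ b) = bound a ⊔ bound b
bound (a ∨ᶠ b) = bound a ⊔ bound b
bound (a ⇒ᶠ b) = bound a ⊔ bound b

Agree : ℕ → (ℕ → Bool) → (ℕ → Bool) → Set
Agree n u v = ∀ {p} → p < n → u p ≡ v p

Agree-mono : ∀ {m n u v} → m ≤ n → Agree n u v → Agree m u v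
Agree-mono m≤n agree p<m = agree (<-≤-trans p<m m≤n)

Agree-⊔ˡ : ∀ {m n u v} → Agree (m ⊔ n) u v → Agree m u v
Agree-⊔ˡ = Agree-mono (m≤m⊔n _ _)

Agree-⊔ʳ : ∀ {m n u v} → Agree (m ⊔ n) u v → Agree n u v
Agree-⊔ʳ {m} = Agree-mono (m≤n⊔m m _)

eval-agree : ∀ A {u v} → Agree (bound A) u v → eval u A ≡ eval v A
eval-agree (atom p) agree = agree (n<1+n p)
eval-agree ⊤ᶠ _ = refl
eval-agree ⊥ᶠ _ = refl
eval-agree (¬ᶠ a) agree = cong not (eval-agree a agree)
eval-agree (a ∧ᶠ b) agree =
  cong₂ _∧_ (eval-agree a (Agree-⊔ˡ agree)) (eval-agree b (Agree-⊔ʳ agree))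
eval-agree (a ∨ᶠ b) agree =
  cong₂ _∨_ (eval-agree a (Agree-⊔ˡ agree)) (eval-agree b (Agree-⊔ʳ agree))
eval-agree (a ⇒ᶠ b) agree =
  cong₂ (λ x y → not x ∨ y) (eval-agree a (Agree-⊔ˡ agree)) (eval-agree b (Agree-⊔ʳ agree))

fromVec : ∀ {n} → Vec Bool n → ℕ → Bool
fromVec {n} bs p with p <? n
... | yes p<n = lookup bs (fromℕ< p<n)
... | no _    = false

toVec : ∀ n → (ℕ → Bool) → Vec Bool n
toVec n v = tabulate (v ∘ toℕ)

fromVec-toVec : ∀ n v → Agree n (fromVec (toVec n v)) v
fromVec-toVec n v {p} p<n with p <? n
... | yes q  = trans (lookup∘tabulate (v ∘ toℕ) (fromℕ< q)) (cong v (toℕ-fromℕ< q))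
... | no ¬q  = ⊥-elim (¬q p<n)

-- Only the atoms below the bound matter, so it suffices to search the 2ⁿ assignments to them.
⊨-or-countermodel : ∀ C A → C ⊨ A ⊎ ∃ λ v → eval v C ≡ true × eval v A ≡ false
⊨-or-countermodel C A = search (bound C ⊔ bound A) (m≤m⊔n _ _) (m≤n⊔m _ _)
  where
  search : ∀ n → bound C ≤ n → bound A ≤ n → C ⊨ A ⊎ ∃ λ v → eval v C ≡ true × eval v A ≡ false
  search n C≤n A≤n with anySubset? (λ (bs : Vec Bool n) → (eval (fromVec bs) C ≟ true) ×-dec (eval (fromVec bs) A ≟ false))
  ... | yes (bs , counter) = inj₂ (fromVec bs , counter)
  ... | no none = inj₁ λ v hC →
    let restrict : ∀ X → bound X ≤ n → eval (fromVec (toVec n v)) X ≡ eval v X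
        restrict X X≤n = eval-agree X (Agree-mono X≤n (fromVec-toVec n v))
    in trans (sym (restrict A A≤n)) (¬-not λ hA → none (toVec n v , trans (restrict C C≤n) hC , hA))

satisfiable? : ∀ C → C ⊨ ⊥ᶠ ⊎ ∃ λ v → eval v C ≡ true
satisfiable? C = [ inj₁ , (λ (v , hC , _) → inj₂ (v , hC)) ]′ (⊨-or-countermodel C ⊥ᶠ)

_⊨?_ : ∀ C A → Dec (C ⊨ A)
C ⊨? A = [ yes , (λ (v , hC , hA) → no λ C⊨A → not-¬ hA (C⊨A v hC)) ]′ (⊨-or-countermodel C A)

⊨⊥-no-model : ∀ {C v} → C ⊨ ⊥ᶠ → eval v C ≡ true → ⊥
⊨⊥-no-model C⊨⊥ hC with C⊨⊥ _ hC
... | ()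

literal : ℕ → Bool → PForm
literal n true  = atom n
literal n false = ¬ᶠ atom n

literal-value : ∀ {v} n b → eval v (literal n b) ≡ true → v n ≡ b
literal-value n true  h = h
literal-value {v} n false h with v n
literal-value n false () | true
... | false = refl

minterm : ∀ n → Vec Bool n → PForm
minterm zero    []       = ⊤ᶠ
minterm (suc n) (b ∷ bs) = literal n b ∧ᶠ minterm n bs

minterm-pins : ∀ {n bs u v} → eval u (minterm n bs) ≡ true → eval v (minterm n bs) ≡ true → Agree n u v
minterm-pins {suc n} {b ∷ bs} hu hv {p} p<1+n with m<1+n⇒m<n∨m≡n p<1+n
... | inj₁ p<n  = minterm-pins (∧-elimʳ hu) (∧-elimʳ hv) p<n
... | inj₂ refl = trans (literal-value n b (∧-elimˡ hu)) (sym (literal-value n b (∧-elimˡ hv)))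

minterm-decides : ∀ {C n bs u} A → C ⊨ minterm n bs → eval u C ≡ true → bound A ≤ n
                → eval u A ≡ true → C ⊨ A
minterm-decides A C⊨m hu A≤n hA v hv =
  trans (eval-agree A (Agree-mono A≤n (minterm-pins (C⊨m v hv) (C⊨m _ hu)))) hA

⊨-∧ˡ : ∀ A B → (A ∧ᶠ B) ⊨ A
⊨-∧ˡ A B v = ∧-elimˡ {eval v A}

⊨-∧ʳ : ∀ A B → (A ∧ᶠ B) ⊨ B
⊨-∧ʳ A B v = ∧-elimʳ {eval v A}

⊢-⊥ : ∀ {G L Y} → hasBOT L ≡ true → G ⊢[ L ] (⊥ᶠ , Y)
⊢-⊥ e = WO (BOT e) λ _ ()

⋀outputs : List Pair → PForm
⋀outputs []      = ⊤ᶠ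
⋀outputs (p ∷ U) = proj₂ p ∧ᶠ ⋀outputs U

⋀outputs-∈ : ∀ {v U p} → eval v (⋀outputs U) ≡ true → p ∈ U → eval v (proj₂ p) ≡ true
⋀outputs-∈ h (here refl) = ∧-elimˡ h
⋀outputs-∈ h (there p∈U) = ⋀outputs-∈ (∧-elimʳ h) p∈U

⊢-⋀outputs : ∀ {G L D} U → (∀ {p} → p ∈ U → G ⊢[ L ] (D , proj₂ p)) → G ⊢[ L ] (D , ⋀outputs U)
⊢-⋀outputs []      _ = SI TOP λ _ _ → refl
⊢-⋀outputs (p ∷ U) d = AND (d (here refl)) (⊢-⋀outputs U (d ∘ there))

⊢-split-minterms : ∀ {G L Y} → hasOR L ≡ true → ∀ n C
                 → (∀ bs → G ⊢[ L ] (C ∧ᶠ minterm n bs , Y)) → G ⊢[ L ] (C , Y)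
⊢-split-minterms e zero    C d = SI (d []) λ _ hC → ∧-intro hC refl
⊢-split-minterms {G} {L} {Y} e (suc n) C d = SI (OR e (branch true) (branch false)) excluded-middle
  where
  reassoc : ∀ a m → ((C ∧ᶠ a) ∧ᶠ m) ⊨ (C ∧ᶠ a ∧ᶠ m)
  reassoc a m v h = trans (sym (∧-assoc (eval v C) (eval v a) (eval v m))) h
  branch : ∀ b → G ⊢[ L ] (C ∧ᶠ literal n b , Y)
  branch b = ⊢-split-minterms e n (C ∧ᶠ literal n b) λ bs →
    SI (d (b ∷ bs)) (reassoc (literal n b) (minterm n bs))
  excluded-middle : C ⊨ ((C ∧ᶠ atom n) ∨ᶠ (C ∧ᶠ ¬ᶠ atom n))
  excluded-middle v hC rewrite hC = ∨-inverseʳ (v n)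

data FanStep {I : Set} : Maybe I → Maybe I → Set where
  root→leaf : ∀ i → FanStep nothing (just i)
  leaf-loop : ∀ i → FanStep (just i) (just i)

-- nothing is the root; the leaves see themselves so that the fan is serial when I is inhabited.
fan : (ℕ → Bool) → {I : Set} → (I → ℕ → Bool) → Model
fan v {I} s = record { W = Maybe I ; R = FanStep ; V = maybe s v }

fan-□⁺ : ∀ {v I} {s : I → ℕ → Bool} A → (∀ i → eval (s i) A ≡ true) → fan v s , nothing ⊩ (□ ⌜ A ⌝)
fan-□⁺ A h (just i) (root→leaf i) = eval⇒forces A (h i)

fan-□⁻ : ∀ {v I} {s : I → ℕ → Bool} A → fan v s , nothing ⊩ (□ ⌜ A ⌝) → ∀ i → eval (s i) A ≡ true
fan-□⁻ A h i = forces⇒eval A (h (just i) (root→leaf i))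

fan-serial : ∀ {v I} {s : I → ℕ → Bool} → I → Serial (fan v s)
fan-serial i nothing  = just i , root→leaf i
fan-serial _ (just j) = just j , leaf-loop j

fan-functional : ∀ {v I} {s : I → ℕ → Bool} → Irrelevant I → AtMostOneSucc (fan v s)
fan-functional irr _ _ _ (root→leaf i) (root→leaf j) = cong just (irr i j)
fan-functional irr _ _ _ (leaf-loop i) (leaf-loop .i) = refl

Fits : ModalLogic → Set → Set
Fits K    I = Unit
Fits KD   I = I
Fits K+F  I = Irrelevant I
Fits KD+F I = I × Irrelevant I

fan-frame : ∀ ml {v I} {s : I → ℕ → Bool} → Fits ml I → FrameOf ml (fan v s)
fan-frame K    _ = tt
fan-frame KD   {v} {s = s} i         = fan-serial {v} {s = s} i
fan-frame K+F  {v} {s = s} irr       = fan-functional {v} {s = s} irr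
fan-frame KD+F {v} {s = s} (i , irr) = fan-serial {v} {s = s} i , fan-functional {v} {s = s} irr

module Completeness (G : List Pair) (B Y : PForm) where

  N : ℕ
  N = max 0 (map (bound ∘ proj₁) G)

  antecedent-bound : ∀ {p} → p ∈ G → bound (proj₁ p) ≤ N
  antecedent-bound p∈G = All.lookup (xs≤max 0 (map (bound ∘ proj₁) G)) (∈-map⁺ (bound ∘ proj₁) p∈G)

  -- As the successors of a fan, these make its root force □ A, for A an antecedent of G, exactly when C ⊨ A.
  record Reflecting (C : PForm) : Set₁ where
    field
      I        : Set
      world    : I → ℕ → Bool
      models   : ∀ i → eval (world i) C ≡ true
      reflects : ∀ {p} → p ∈ G → (∀ i → eval (world i) (proj₁ p) ≡ true) → C ⊨ proj₁ p
  open Reflecting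

  allModels : ∀ C → Reflecting C
  allModels C = record
    { I        = ∃ λ u → eval u C ≡ true
    ; world    = proj₁
    ; models   = proj₂
    ; reflects = λ _ holds u hu → holds (u , hu)
    }

  singleModel : ∀ {C bs u} → C ⊨ minterm N bs → eval u C ≡ true → Reflecting C
  singleModel {C} {u = u} C⊨m hu = record
    { I        = Unit
    ; world    = λ _ → u
    ; models   = λ _ → hu
    ; reflects = λ {p} p∈G holds → minterm-decides {C} (proj₁ p) C⊨m hu (antecedent-bound p∈G) (holds tt)
    }

  root₁₂ : ∀ {ml v I} {s : I → ℕ → Bool} → G□₁₂ G ⊨[ ml ] tr₁₂ (B , Y) → FrameOf ml (fan v s)
         → (∀ i → eval (s i) B ≡ true)
         → (∀ {p} → p ∈ G → (∀ i → eval (s i) (proj₁ p) ≡ true) → eval v (proj₂ p) ≡ true)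
         → eval v Y ≡ true
  root₁₂ {v = v} {s = s} hyp fr sB sG = forces⇒eval Y (hyp (fan v s) fr nothing premises (fan-□⁺ B sB))
    where
    premises : ∀ φ → φ ∈ G□₁₂ G → fan v s , nothing ⊩ φ
    premises φ φ∈ with ∈-map⁻ tr₁₂ φ∈
    ... | (A , X) , p∈G , refl = λ □A → eval⇒forces X (sG p∈G (fan-□⁻ A □A))

  root₃₄ : ∀ {ml v I} {s : I → ℕ → Bool} → G□₃₄ G ⊨[ ml ] tr₃₄ (B , Y) → FrameOf ml (fan v s)
         → (∀ i → eval (s i) B ≡ true)
         → (∀ {p} → p ∈ G → (∀ i → eval (s i) (proj₁ p) ≡ true)
                  → eval v (proj₂ p) ≡ true × (∀ i → eval (s i) (proj₂ p) ≡ true))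
         → eval v Y ≡ true
  root₃₄ {v = v} {s = s} hyp fr sB sG = forces⇒eval Y (proj₁ (hyp (fan v s) fr nothing premises (fan-□⁺ B sB)))
    where
    premises : ∀ φ → φ ∈ G□₃₄ G → fan v s , nothing ⊩ φ
    premises φ φ∈ with ∈-map⁻ tr₃₄ φ∈
    ... | (A , X) , p∈G , refl = λ □A → let (x , sX) = sG p∈G (fan-□⁻ A □A) in eval⇒forces X x , fan-□⁺ X sX

  Derivable : Sys → PForm → List Pair → Set
  Derivable L D U = ∀ {p} → p ∈ U → G ⊢[ L ] (D , proj₂ p)

  module Saturation (L : Sys) (D : PForm) (ctx : List Pair → PForm)
    (extend : ∀ U → Derivable L D U → ∀ {p} → p ∈ G → ctx U ⊨ proj₁ p → G ⊢[ L ] (D , proj₂ p)) where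

    record Saturated : Set where
      field
        U          : List Pair
        derivable  : Derivable L D U
        closed     : ∀ {p} → p ∈ G → ctx U ⊨ proj₁ p → p ∈ U

    Triggered : List Pair → Pred Pair _
    Triggered U p = ctx U ⊨ proj₁ p

    triggered? : ∀ U → Decidable (Triggered U)
    triggered? U p = ctx U ⊨? proj₁ p

    untriggered? : ∀ U → Decidable (∁ (Triggered U))
    untriggered? U p = ¬? (triggered? U p)

    saturate : ∀ U R → Acc _<_ (length R) → (∀ {p} → p ∈ R → p ∈ G) → Derivable L D U
             → (∀ {p} → p ∈ G → p ∈ U ⊎ p ∈ R) → Saturated
    saturate U R _ _ der cover with any? (triggered? U) R
    ... | no none = record
      { U = U ; derivable = der
      ; closed = λ p∈G e → [ id , (λ p∈R → ⊥-elim (none (lose p∈R e))) ]′ (cover p∈G) }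
    saturate U R (acc rs) R⊆G der cover | yes some =
      saturate (T ++ U) R′ (rs shorter) (λ p∈R′ → R⊆G (proj₁ (∈-filter⁻ (untriggered? U) p∈R′))) der′ cover′
      where
      T R′ : List Pair
      T  = filter (triggered? U) R
      R′ = filter (untriggered? U) R
      shorter : length R′ < length R
      shorter = filter-notAll (untriggered? U) R (Any.map (λ e ¬e → ¬e e) some)
      der′ : Derivable L D (T ++ U)
      der′ p∈ with ∈-++⁻ T p∈
      ... | inj₁ p∈T = let (p∈R , e) = ∈-filter⁻ (triggered? U) p∈T in extend U der (R⊆G p∈R) e
      ... | inj₂ p∈U = der p∈U
      cover′ : ∀ {p} → p ∈ G → p ∈ T ++ U ⊎ p ∈ R′
      cover′ {p} p∈G with cover p∈G
      ... | inj₁ p∈U = inj₁ (∈-++⁺ʳ T p∈U)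
      ... | inj₂ p∈R with triggered? U p
      ...   | yes e = inj₁ (∈-++⁺ˡ (∈-filter⁺ (triggered? U) p∈R e))
      ...   | no ¬e = inj₂ (∈-filter⁺ (untriggered? U) p∈R ¬e)

    saturated : Saturated
    saturated = saturate [] G (<-wellFounded _) id (λ ()) inj₂

    open Saturated saturated public

  module Via₁₂ (L : Sys) (D : PForm) (D⊨B : D ⊨ B) where
    open Saturation L D (λ _ → D) (λ _ _ p∈G D⊨A → SI (leaf p∈G) D⊨A)

    derive : ∀ {ml} → G□₁₂ G ⊨[ ml ] tr₁₂ (B , Y) → (F : Reflecting D) → Fits ml (I F) → G ⊢[ L ] (D , Y)
    derive {ml} hyp F fits = WO (⊢-⋀outputs U derivable) λ v hU →
      root₁₂ hyp (fan-frame ml fits) (λ i → D⊨B _ (models F i))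
        λ p∈G holds → ⋀outputs-∈ hU (closed p∈G (reflects F p∈G holds))

    derive-⊥ : hasBOT L ≡ true → D ⊨ ⊥ᶠ → G ⊢[ L ] (D , Y)
    derive-⊥ e D⊨⊥ = SI (⊢-⊥ e) D⊨⊥

  module Via₃₄ (L : Sys) (ct : hasCT L ≡ true) (D : PForm) (D⊨B : D ⊨ B) where
    open Saturation L D (λ U → D ∧ᶠ ⋀outputs U) (λ U der p∈G e → CT ct (⊢-⋀outputs U der) (SI (leaf p∈G) e))

    Ctx : PForm
    Ctx = D ∧ᶠ ⋀outputs U

    Ctx⊨D : Ctx ⊨ D
    Ctx⊨D = ⊨-∧ˡ D (⋀outputs U)

    derive : ∀ {ml} → G□₃₄ G ⊨[ ml ] tr₃₄ (B , Y) → (F : Reflecting Ctx) → Fits ml (I F) → G ⊢[ L ] (D , Y)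
    derive {ml} hyp F fits = WO (⊢-⋀outputs U derivable) λ v hU →
      root₃₄ hyp (fan-frame ml fits) (λ i → D⊨B _ (Ctx⊨D _ (models F i)))
        λ p∈G holds → let p∈U = closed p∈G (reflects F p∈G holds) in
          ⋀outputs-∈ hU p∈U , λ i → ⋀outputs-∈ (∧-elimʳ (models F i)) p∈U

    derive-⊥ : hasBOT L ≡ true → Ctx ⊨ ⊥ᶠ → G ⊢[ L ] (D , Y)
    derive-⊥ e Ctx⊨⊥ = CT ct (⊢-⋀outputs U derivable) (SI (⊢-⊥ e) Ctx⊨⊥)

  module _ {C : PForm} {Goal : Set} where

    viaKD : (C ⊨ ⊥ᶠ → Goal) → ((F : Reflecting C) → Fits KD (I F) → Goal) → Goal
    viaKD unsat derive with satisfiable? C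
    ... | inj₁ C⊨⊥     = unsat C⊨⊥
    ... | inj₂ (u , hu) = derive (allModels C) (u , hu)

    viaK+F : ∀ {bs} → C ⊨ minterm N bs → ((F : Reflecting C) → Fits K+F (I F) → Goal) → Goal
    viaK+F C⊨m derive with satisfiable? C
    ... | inj₁ C⊨⊥     = derive (allModels C) λ (u , hu) _ → ⊥-elim (⊨⊥-no-model {C} C⊨⊥ hu)
    ... | inj₂ (u , hu) = derive (singleModel C⊨m hu) λ _ _ → refl

    viaKD+F : ∀ {bs} → C ⊨ minterm N bs → (C ⊨ ⊥ᶠ → Goal) → ((F : Reflecting C) → Fits KD+F (I F) → Goal) → Goal
    viaKD+F C⊨m unsat derive with satisfiable? C
    ... | inj₁ C⊨⊥     = unsat C⊨⊥
    ... | inj₂ (u , hu) = derive (singleModel C⊨m hu) (tt , λ _ _ → refl)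

  complete-OUT₁ : G□₁₂ G ⊨[ K ] tr₁₂ (B , Y) → G ⊢[ OUT₁ ] (B , Y)
  complete-OUT₁ hyp = derive hyp (allModels B) tt
    where open Via₁₂ OUT₁ B (λ _ → id)

  complete-OUT₁⁺ : G□₁₂ G ⊨[ KD ] tr₁₂ (B , Y) → G ⊢[ OUT₁⁺ ] (B , Y)
  complete-OUT₁⁺ hyp = viaKD (derive-⊥ refl) (derive hyp)
    where open Via₁₂ OUT₁⁺ B (λ _ → id)

  complete-OUT₃ : G□₃₄ G ⊨[ K ] tr₃₄ (B , Y) → G ⊢[ OUT₃ ] (B , Y)
  complete-OUT₃ hyp = derive hyp (allModels Ctx) tt
    where open Via₃₄ OUT₃ refl B (λ _ → id)

  complete-OUT₃⁺ : G□₃₄ G ⊨[ KD ] tr₃₄ (B , Y) → G ⊢[ OUT₃⁺ ] (B , Y)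
  complete-OUT₃⁺ hyp = viaKD (derive-⊥ refl) (derive hyp)
    where open Via₃₄ OUT₃⁺ refl B (λ _ → id)

  complete-OUT₂ : G□₁₂ G ⊨[ K+F ] tr₁₂ (B , Y) → G ⊢[ OUT₂ ] (B , Y)
  complete-OUT₂ hyp = ⊢-split-minterms refl N B λ bs →
    let open Via₁₂ OUT₂ (B ∧ᶠ minterm N bs) (⊨-∧ˡ B (minterm N bs)) in
    viaK+F (⊨-∧ʳ B (minterm N bs)) (derive hyp)

  complete-OUT₂⁺ : G□₁₂ G ⊨[ KD+F ] tr₁₂ (B , Y) → G ⊢[ OUT₂⁺ ] (B , Y)
  complete-OUT₂⁺ hyp = ⊢-split-minterms refl N B λ bs →
    let open Via₁₂ OUT₂⁺ (B ∧ᶠ minterm N bs) (⊨-∧ˡ B (minterm N bs)) in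
    viaKD+F (⊨-∧ʳ B (minterm N bs)) (derive-⊥ refl) (derive hyp)

  complete-OUT₄ : G□₃₄ G ⊨[ K+F ] tr₃₄ (B , Y) → G ⊢[ OUT₄ ] (B , Y)
  complete-OUT₄ hyp = ⊢-split-minterms refl N B λ bs →
    let open Via₃₄ OUT₄ refl (B ∧ᶠ minterm N bs) (⊨-∧ˡ B (minterm N bs)) in
    viaK+F (λ v → ⊨-∧ʳ B (minterm N bs) v ∘ Ctx⊨D v) (derive hyp)

  complete-OUT₄⁺ : G□₃₄ G ⊨[ KD+F ] tr₃₄ (B , Y) → G ⊢[ OUT₄⁺ ] (B , Y)
  complete-OUT₄⁺ hyp = ⊢-split-minterms refl N B λ bs →
    let open Via₃₄ OUT₄⁺ refl (B ∧ᶠ minterm N bs) (⊨-∧ˡ B (minterm N bs)) in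
    viaKD+F (λ v → ⊨-∧ʳ B (minterm N bs) v ∘ Ctx⊨D v) (derive-⊥ refl) (derive hyp)

theorem5 : (G : List Pair) (B Y : PForm) →
    ((G ⊢[ OUT₁ ] (B , Y)) ⇔ (G□₁₂ G ⊨[ K ] tr₁₂ (B , Y))) ×
    ((G ⊢[ OUT₂ ] (B , Y)) ⇔ (G□₁₂ G ⊨[ K+F ] tr₁₂ (B , Y))) ×
    ((G ⊢[ OUT₃ ] (B , Y)) ⇔ (G□₃₄ G ⊨[ K ] tr₃₄ (B , Y))) ×
    ((G ⊢[ OUT₄ ] (B , Y)) ⇔ (G□₃₄ G ⊨[ K+F ] tr₃₄ (B , Y))) ×
    ((G ⊢[ OUT₁⁺ ] (B , Y)) ⇔ (G□₁₂ G ⊨[ KD ] tr₁₂ (B , Y))) ×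
    ((G ⊢[ OUT₂⁺ ] (B , Y)) ⇔ (G□₁₂ G ⊨[ KD+F ] tr₁₂ (B , Y))) ×
    ((G ⊢[ OUT₃⁺ ] (B , Y)) ⇔ (G□₃₄ G ⊨[ KD ] tr₃₄ (B , Y))) ×
    ((G ⊢[ OUT₄⁺ ] (B , Y)) ⇔ (G□₃₄ G ⊨[ KD+F ] tr₃₄ (B , Y)))
theorem5 G B Y =
  mk⇔ (sound₁₂ refl) complete-OUT₁  ,
  mk⇔ (sound₁₂ refl) complete-OUT₂  ,
  mk⇔ sound₃₄        complete-OUT₃  ,
  mk⇔ sound₃₄        complete-OUT₄  ,
  mk⇔ (sound₁₂ refl) complete-OUT₁⁺ ,
  mk⇔ (sound₁₂ refl) complete-OUT₂⁺ ,
  mk⇔ sound₃₄        complete-OUT₃⁺ ,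
  mk⇔ sound₃₄        complete-OUT₄⁺
  where open Completeness G B Y
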